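{- Let $D_1$ and $D_2$ be simple digraphs on $n_1$ and $n_2$ vertices, respectively. If $D_1$ is $r$-out-regular, then \[ f_{L(D_1 \overrightarrow{\diamond} D_2)} (\lambda)= \big[f_{L(D_2)}(\lambda-1)\big]^{rn_1} \left[\frac{\lambda-n_2-1}{\lambda-1}\right]^{n_1} f_{L(D_1)}\left(\frac{\lambda^2-(rn_2+1)\lambda}{\lambda-n_2-1}\right). \] In particular, when $D_1$ is out-regular, the Laplacian spectrum of $D_1 \overrightarrow{\diamond} D_2$ is completely determined by the Laplacian characteristic polynomials of $D_1$ and $D_2$.
   Context: Digraphs are simple; $r$-out-regular means every vertex has out-degree $r$. $A(D)$ is the adjacency matrix, $D_{\rm out}(D)$ the diagonal out-degree matrix, $L(D)=D_{\rm out}(D)-A(D)$, $f_M(\lambda)=\det(\lambda I-M)$. The forward-arc-corona $D_1 \overrightarrow{\diamond} D_2$ takes one copy of $D_1$ and one disjoint copy of $D_2$ per arc of $D_1$, and for each arc $a_k=uv$ of $D_1$ and each vertex $w$ of the $k$-th copy of $D_2$ adds arcs $uw$ and $wv$. -}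

module Defs where

open import Data.Bool using (Bool; true; false; if_then_else_)
open import Data.Nat as ℕ using (ℕ; zero; suc)
open import Data.Fin as Fin using (Fin; zero; suc; splitAt; quotRem; punchIn; _≟_)
open import Data.List using (List; []; _∷_; length; filter; lookup; concatMap; map)
open import Data.List.Base using (allFin)
open import Data.Product using (_×_; _,_; proj₁; proj₂)
open import Data.Sum using (_⊎_; inj₁; inj₂)
open import Data.Integer using (+_)
open import Data.Rational using (ℚ; 0ℚ; 1ℚ; _+_; _*_; _-_; -_; _/_)
open import Relation.Nullary using (yes; no; does)
open import Relation.Binary.PropositionalEquality using (_≡_)

-- Simple digraphs on vertex set Fin n: an arc relation with no loops.
-- (Multiple arcs are impossible since arcs form a relation.)

record Digraph (n : ℕ) : Set where
  field
    arc      : Fin n → Fin n → Bool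
    loopless : ∀ i → arc i i ≡ false
open Digraph public

Σ[_] : ∀ {n} → (Fin n → ℚ) → ℚ
Σ[_] {zero}  f = 0ℚ
Σ[_] {suc n} f = f zero + Σ[_] (λ i → f (suc i))

Σℕ : ∀ {n} → (Fin n → ℕ) → ℕ
Σℕ {zero}  f = 0
Σℕ {suc n} f = f zero ℕ.+ Σℕ (λ i → f (suc i))

ℕtoℚ : ℕ → ℚ
ℕtoℚ k = (+ k) / 1

_^_ : ℚ → ℕ → ℚ
x ^ zero  = 1ℚ
x ^ suc k = x * (x ^ k)

outdeg : ∀ {n} → Digraph n → Fin n → ℕ
outdeg D u = Σℕ (λ v → if arc D u v then 1 else 0)

OutRegular : ∀ {n} → ℕ → Digraph n → Set
OutRegular r D = ∀ u → outdeg D u ≡ r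

Matrix : ℕ → Set
Matrix n = Fin n → Fin n → ℚ

sign : ℕ → ℚ
sign zero          = 1ℚ
sign (suc zero)    = - 1ℚ
sign (suc (suc k)) = sign k

det : ∀ {n} → Matrix n → ℚ
det {zero}  M = 1ℚ
det {suc n} M =
  Σ[ (λ j → sign (Fin.toℕ j) * M zero j * det (λ i k → M (suc i) (punchIn j k))) ]

δ : ∀ {n} → Fin n → Fin n → ℚ
δ i j = if does (i ≟ j) then 1ℚ else 0ℚ

charPoly : ∀ {n} → Matrix n → ℚ → ℚ
charPoly M x = det (λ i j → x * δ i j - M i j)

adjacency : ∀ {n} → Digraph n → Matrix n
adjacency D i j = if arc D i j then 1ℚ else 0ℚ

laplacian : ∀ {n} → Digraph n → Matrix n
laplacian D i j = ℕtoℚ (outdeg D i) * δ i j - adjacency D i j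

-- Arcs of D₁ listed as a_0, …, a_{m-1}; vertices of the corona are
-- Fin (n₁ + m * n₂): first the vertices of D₁, then (via quotRem)
-- pairs (w, k) meaning vertex w of the k-th copy of D₂.

arcList : ∀ {n} → Digraph n → List (Fin n × Fin n)
arcList {n} D =
  filter (λ p → Data.Bool.T? (arc D (proj₁ p) (proj₂ p)))
         (concatMap (λ u → map (λ v → (u , v)) (allFin n)) (allFin n))
  where import Data.Bool

numArcs : ∀ {n} → Digraph n → ℕ
numArcs D = length (arcList D)

arcAt : ∀ {n} (D : Digraph n) → Fin (numArcs D) → Fin n × Fin n
arcAt D k = lookup (arcList D) k

coronaSize : ∀ {n₁ n₂} → Digraph n₁ → Digraph n₂ → ℕ
coronaSize {n₁} {n₂} D₁ D₂ = n₁ ℕ.+ numArcs D₁ ℕ.* n₂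

data CVertex {n₁ n₂} (D₁ : Digraph n₁) (D₂ : Digraph n₂) : Set where
  base : Fin n₁ → CVertex D₁ D₂
  copy : Fin (numArcs D₁) → Fin n₂ → CVertex D₁ D₂

decode : ∀ {n₁ n₂} (D₁ : Digraph n₁) (D₂ : Digraph n₂) →
         Fin (coronaSize D₁ D₂) → CVertex D₁ D₂
decode {n₁} {n₂} D₁ D₂ i with splitAt n₁ i
... | inj₁ u = base u
... | inj₂ j with quotRem {numArcs D₁} n₂ j
...   | (w , k) = copy k w

cArc : ∀ {n₁ n₂} (D₁ : Digraph n₁) (D₂ : Digraph n₂) →
       CVertex D₁ D₂ → CVertex D₁ D₂ → Bool
cArc D₁ D₂ (base u) (base v) = arc D₁ u v
cArc D₁ D₂ (base u) (copy k w) = does (u ≟ proj₁ (arcAt D₁ k))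
cArc D₁ D₂ (copy k w) (base v) = does (v ≟ proj₂ (arcAt D₁ k))
cArc D₁ D₂ (copy k w) (copy k' w') =
  if does (k ≟ k') then arc D₂ w w' else false

corona : ∀ {n₁ n₂} (D₁ : Digraph n₁) (D₂ : Digraph n₂) →
         Digraph (coronaSize D₁ D₂)
corona D₁ D₂ = record
  { arc      = λ i j → cArc D₁ D₂ (decode D₁ D₂ i) (decode D₁ D₂ j)
  ; loopless = λ i → lem (decode D₁ D₂ i)
  }
  where
  lem : ∀ x → cArc D₁ D₂ x x ≡ false
  lem (base u) = loopless D₁ u
  lem (copy k w) with k ≟ k
  ... | yes _ = loopless D₂ w
  ... | no  _ = Relation.Binary.PropositionalEquality.refl

-- In χ = xI − L(D₁ →◇ D₂) the row of a vertex of copy k has a single base entry, 1 in the column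
-- of head(k), and its copy part is block diagonal with blocks (x − 1)I − L(D₂), whose rows sum to x − 1
-- because Laplacian rows sum to 0. Adding to every base column v the multiple −1/(x − 1) of all
-- columns of the copies attached to arcs with head v therefore clears the block of copy rows and base
-- columns, and det χ becomes the determinant of the new base block times f_{L(D₂)}(x − 1)^m. The base
-- row of u meets the columns of copy k in [u = tail(k)], so the new base block is
-- xI − (1 + n₂)·D_out(D₁) + (1 − n₂/(x − 1))·A(D₁). For r-out-regular D₁ we have m = r·n₁, and this
-- block is (x − 1 − n₂)/(x − 1) · (yI − L(D₁)) with y = (x² − (r·n₂ + 1)x)/(x − 1 − n₂).
--
-- The alternation of det needed for column operations comes from adjacent column swaps, each of which
-- negates the first-row Laplace expansion.

module Submission where

open import Defs
open import Data.Nat using (ℕ; suc)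
open import Data.Rational using (ℚ; 1ℚ; _+_; _*_; _-_; _÷_; NonZero)
open import Relation.Binary.PropositionalEquality using (_≡_)

open import Algebra.Bundles using (CommutativeRing)
open import Data.Bool using (Bool; true; false; if_then_else_; T?)
open import Data.Empty using (⊥-elim)
open import Data.Fin as Fin using (Fin; zero; suc; toℕ; punchIn; inject₁; _↑ˡ_; _↑ʳ_; combine; remQuot; fromℕ<)
import Data.Fin.Permutation as Perm
open import Data.Fin.Permutation.Components using (transpose)
import Data.Fin.Properties as Finₚ
import Data.Integer as ℤ
import Data.Integer.Properties as ℤₚ
open import Data.List using (List; []; _∷_)
import Data.List as List
import Data.List.Properties as Listₚ
import Data.Nat as ℕ
open import Data.Nat.Coprimality using (1-coprimeTo) renaming (sym to Coprime-sym)
import Data.Nat.Properties as ℕₚ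
open import Data.Product using (∃; _×_; _,_; proj₁; proj₂; uncurry; swap)
import Data.Rational as ℚ
open import Data.Rational using (0ℚ; ½; -_; 1/_; mkℚ; _/_)
import Data.Rational.Properties as ℚₚ
open import Data.Rational.Solver using (module +-*-Solver)
open import Data.Sum using (_⊎_; inj₁; inj₂; [_,_]′)
open import Function using (_∘_)
open import Relation.Binary.Definitions using (tri<; tri≈; tri>)
open import Relation.Binary.PropositionalEquality using (_≢_; refl; sym; trans; cong; cong₂; subst; module ≡-Reasoning)
open import Relation.Nullary using (¬_; Dec; yes; no; does)
open import Relation.Nullary.Decidable using (dec-true; dec-false)

open import Algebra.Properties.Semiring.Sum (CommutativeRing.semiring ℚₚ.+-*-commutativeRing)
  using (sum; sum-cong-≗; sum-remove; ∑-distrib-+; ∑-comm; *-distribˡ-sum; *-distribʳ-sum; sum-permute)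
open +-*-Solver
open ≡-Reasoning

ℕtoℚ≡mkℚ : ∀ a → ℕtoℚ a ≡ mkℚ (ℤ.+ a) 0 (Coprime-sym (1-coprimeTo a))
ℕtoℚ≡mkℚ a = ℚₚ.normalize-coprime (Coprime-sym (1-coprimeTo a))

ℕtoℚ-+ : ∀ a b → ℕtoℚ (a ℕ.+ b) ≡ ℕtoℚ a + ℕtoℚ b
ℕtoℚ-+ a b rewrite ℕtoℚ≡mkℚ a | ℕtoℚ≡mkℚ b =
  cong (_/ 1) (trans (ℤₚ.pos-+ a b) (sym (cong₂ ℤ._+_ (ℤₚ.*-identityʳ (ℤ.+ a)) (ℤₚ.*-identityʳ (ℤ.+ b)))))

ℕtoℚ-* : ∀ a b → ℕtoℚ (a ℕ.* b) ≡ ℕtoℚ a * ℕtoℚ b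
ℕtoℚ-* a b rewrite ℕtoℚ≡mkℚ a | ℕtoℚ≡mkℚ b = cong (_/ 1) (ℤₚ.pos-* a b)

ℕtoℚ-injective : ∀ {a b} → ℕtoℚ a ≡ ℕtoℚ b → a ≡ b
ℕtoℚ-injective {a} {b} eq =
  ℤₚ.+-injective (cong ℚ.numerator (trans (sym (ℕtoℚ≡mkℚ a)) (trans eq (ℕtoℚ≡mkℚ b))))

≡-neg⇒≡0 : ∀ {x} → x ≡ - x → x ≡ 0ℚ
≡-neg⇒≡0 {x} x≡-x = begin
  x              ≡⟨ solve 1 (λ x → x := con ½ :* (x :+ x)) refl x ⟩
  ½ * (x + x)    ≡⟨ cong (λ y → ½ * (x + y)) x≡-x ⟩
  ½ * (x + - x)  ≡⟨ solve 1 (λ x → con ½ :* (x :+ :- x) := con 0ℚ) refl x ⟩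
  0ℚ             ∎

neg≡0⇒≡0 : ∀ {x} → - x ≡ 0ℚ → x ≡ 0ℚ
neg≡0⇒≡0 {x} -x≡0 = trans (solve 1 (λ x → x := :- (:- x)) refl x) (cong -_ -x≡0)

Σ≡sum : ∀ {n} (f : Fin n → ℚ) → Σ[ f ] ≡ sum f
Σ≡sum {0}     f = refl
Σ≡sum {suc n} f = cong (f zero +_) (Σ≡sum (f ∘ suc))

sum-zero : ∀ {n} {f : Fin n → ℚ} → (∀ i → f i ≡ 0ℚ) → sum f ≡ 0ℚ
sum-zero {0}     _   = refl
sum-zero {suc n} f≡0 = cong₂ _+_ (f≡0 zero) (sum-zero (f≡0 ∘ suc))

sum-const : ∀ n (c : ℚ) → sum {n} (λ _ → c) ≡ ℕtoℚ n * c
sum-const 0       c = sym (ℚₚ.*-zeroˡ c)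
sum-const (suc n) c = begin
  c + sum {n} (λ _ → c)  ≡⟨ cong (c +_) (sum-const n c) ⟩
  c + ℕtoℚ n * c         ≡⟨ solve 2 (λ c n → c :+ n :* c := (con 1ℚ :+ n) :* c) refl c (ℕtoℚ n) ⟩
  (1ℚ + ℕtoℚ n) * c      ≡⟨ cong (_* c) (ℕtoℚ-+ 1 n) ⟨
  ℕtoℚ (suc n) * c       ∎

sum-neg : ∀ {n} (f : Fin n → ℚ) → sum (λ i → - f i) ≡ - sum f
sum-neg {0}     f = refl
sum-neg {suc n} f =
  trans (cong (- f zero +_) (sum-neg (f ∘ suc))) (sym (ℚₚ.neg-distrib-+ (f zero) (sum (f ∘ suc))))

sum-↑ : ∀ a {b} (f : Fin (a ℕ.+ b) → ℚ) → sum f ≡ sum (λ i → f (i ↑ˡ b)) + sum (λ j → f (a ↑ʳ j))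
sum-↑ 0       f = sym (ℚₚ.+-identityˡ (sum f))
sum-↑ (suc a) f = trans (cong (f zero +_) (sum-↑ a (f ∘ suc))) (sym (ℚₚ.+-assoc (f zero) _ _))

sum-combine : ∀ m {n} (f : Fin (m ℕ.* n) → ℚ) →
  sum f ≡ sum (λ (k : Fin m) → sum (λ (w : Fin n) → f (combine k w)))
sum-combine 0           f = refl
sum-combine (suc m) {n} f =
  trans (sum-↑ n f) (cong (sum (λ w → f (w ↑ˡ (m ℕ.* n))) +_) (sum-combine m (λ j → f (n ↑ʳ j))))

sum-if : ∀ {n} b (f : Fin n → ℚ) → sum (λ w → if b then f w else 0ℚ) ≡ (if b then sum f else 0ℚ)
sum-if     true  f = refl
sum-if {n} false f = sum-zero {n} {λ _ → 0ℚ} λ _ → refl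

indicator : Bool → ℚ
indicator b = if b then 1ℚ else 0ℚ

ℕtoℚ-indicator : ∀ b → ℕtoℚ (if b then 1 else 0) ≡ indicator b
ℕtoℚ-indicator true  = refl
ℕtoℚ-indicator false = refl

ℕtoℚ-Σℕ : ∀ {n} (f : Fin n → ℕ) → ℕtoℚ (Σℕ f) ≡ sum (ℕtoℚ ∘ f)
ℕtoℚ-Σℕ {0}     f = refl
ℕtoℚ-Σℕ {suc n} f =
  trans (ℕtoℚ-+ (f zero) (Σℕ (f ∘ suc))) (cong (ℕtoℚ (f zero) +_) (ℕtoℚ-Σℕ (f ∘ suc)))

δ-refl : ∀ {n} (i : Fin n) → δ i i ≡ 1ℚ
δ-refl i rewrite dec-true (i Fin.≟ i) refl = refl

δ-≢ : ∀ {n} {i j : Fin n} → i ≢ j → δ i j ≡ 0ℚ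
δ-≢ {i = i} {j} i≢j rewrite dec-false (i Fin.≟ j) i≢j = refl

δ-sym : ∀ {n} (i j : Fin n) → δ i j ≡ δ j i
δ-sym i j with i Fin.≟ j
... | yes refl = sym (δ-refl i)
... | no  i≢j  = sym (δ-≢ (i≢j ∘ sym))

δ-injective : ∀ {m n} (f : Fin m → Fin n) → (∀ {a b} → f a ≡ f b → a ≡ b) → ∀ a b → δ (f a) (f b) ≡ δ a b
δ-injective f f-injective a b with a Fin.≟ b
... | yes refl = δ-refl (f a)
... | no  a≢b  = δ-≢ (a≢b ∘ f-injective)

if-δ : ∀ {n} (k k′ : Fin n) (a : ℚ) → (if does (k Fin.≟ k′) then a else 0ℚ) ≡ a * δ k k′
if-δ k k′ a with does (k Fin.≟ k′)
... | true  = sym (ℚₚ.*-identityʳ a)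
... | false = sym (ℚₚ.*-zeroʳ a)

sum-δ : ∀ {n} (i : Fin n) (f : Fin n → ℚ) → sum (λ j → f j * δ i j) ≡ f i
sum-δ {suc n} i f = begin
  sum (λ j → f j * δ i j)
    ≡⟨ sum-remove (λ j → f j * δ i j) ⟩
  f i * δ i i + sum (λ l → f (punchIn i l) * δ i (punchIn i l))
    ≡⟨ cong₂ _+_ (cong (f i *_) (δ-refl i)) (sum-zero off-diagonal) ⟩
  f i * 1ℚ + 0ℚ
    ≡⟨ solve 1 (λ x → x :* con 1ℚ :+ con 0ℚ := x) refl (f i) ⟩
  f i
    ∎
  where
  off-diagonal : ∀ l → f (punchIn i l) * δ i (punchIn i l) ≡ 0ℚ
  off-diagonal l = trans (cong (f (punchIn i l) *_) (δ-≢ (Finₚ.punchInᵢ≢i i l ∘ sym))) (ℚₚ.*-zeroʳ (f (punchIn i l)))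

-- Determinants

minor : ∀ {n} → Matrix (suc n) → Fin (suc n) → Matrix n
minor M j i k = M (suc i) (punchIn j k)

expansionTerm : ∀ {n} → Matrix (suc n) → Fin (suc n) → ℚ
expansionTerm M j = sign (toℕ j) * M zero j * det (minor M j)

det-expand : ∀ {n} (M : Matrix (suc n)) → det M ≡ sum (expansionTerm M)
det-expand M = Σ≡sum (expansionTerm M)

det-cong : ∀ {n} {M N : Matrix n} → (∀ i j → M i j ≡ N i j) → det M ≡ det N
det-cong {0}             M≡N = refl
det-cong {suc n} {M} {N} M≡N = begin
  det M                  ≡⟨ det-expand M ⟩
  sum (expansionTerm M)  ≡⟨ sum-cong-≗ termwise ⟩
  sum (expansionTerm N)  ≡⟨ det-expand N ⟨
  det N                  ∎
  where
  termwise : ∀ j → expansionTerm M j ≡ expansionTerm N j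
  termwise j = cong₂ (λ a d → sign (toℕ j) * a * d) (M≡N zero j) (det-cong (λ i k → M≡N (suc i) (punchIn j k)))

det-scale : ∀ {n} (c : ℚ) (M : Matrix n) → det (λ i j → c * M i j) ≡ c ^ n * det M
det-scale {0}     c M = sym (ℚₚ.*-identityˡ 1ℚ)
det-scale {suc n} c M = begin
  det cM                                     ≡⟨ det-expand cM ⟩
  sum (expansionTerm cM)                     ≡⟨ sum-cong-≗ scaled-term ⟩
  sum (λ j → c ^ suc n * expansionTerm M j)  ≡⟨ *-distribˡ-sum (c ^ suc n) (expansionTerm M) ⟨
  c ^ suc n * sum (expansionTerm M)          ≡⟨ cong (c ^ suc n *_) (det-expand M) ⟨
  c ^ suc n * det M                          ∎
  where
  cM : Matrix (suc n)
  cM i j = c * M i j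
  scaled-term : ∀ j → expansionTerm cM j ≡ c ^ suc n * expansionTerm M j
  scaled-term j rewrite det-scale c (minor M j) =
    solve 5 (λ s c a p d → s :* (c :* a) :* (p :* d) := (c :* p) :* (s :* a :* d)) refl
      (sign (toℕ j)) c (M zero j) (c ^ n) (det (minor M j))

det-linearInColumn : ∀ {n k} (c : Fin n) (t : Fin k → ℚ) (A : Fin k → Matrix n) (M : Matrix n) →
  (∀ i → M i c ≡ sum (λ d → t d * A d i c)) → (∀ d i l → l ≢ c → A d i l ≡ M i l) →
  det M ≡ sum (λ d → t d * det (A d))
det-linearInColumn {suc n} {k} c t A M column-c other-columns = begin
  det M
    ≡⟨ det-expand M ⟩
  sum (expansionTerm M)
    ≡⟨ sum-cong-≗ termwise ⟩
  sum (λ j → sum (λ d → t d * expansionTerm (A d) j))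
    ≡⟨ ∑-comm (λ j d → t d * expansionTerm (A d) j) ⟩
  sum (λ d → sum (λ j → t d * expansionTerm (A d) j))
    ≡⟨ sum-cong-≗ (λ d → *-distribˡ-sum (t d) (expansionTerm (A d))) ⟨
  sum (λ d → t d * sum (expansionTerm (A d)))
    ≡⟨ sum-cong-≗ (λ d → cong (t d *_) (det-expand (A d))) ⟨
  sum (λ d → t d * det (A d))
    ∎
  where
  termwise : ∀ j → expansionTerm M j ≡ sum (λ d → t d * expansionTerm (A d) j)
  termwise j with j Fin.≟ c
  ... | yes refl = begin
    s * M zero j * det (minor M j)
      ≡⟨ cong (λ a → s * a * det (minor M j)) (column-c zero) ⟩
    s * sum (λ d → t d * A d zero j) * det (minor M j)
      ≡⟨ trans (cong (_* det (minor M j)) (*-distribˡ-sum s (λ d → t d * A d zero j)))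
               (*-distribʳ-sum (det (minor M j)) (λ d → s * (t d * A d zero j))) ⟩
    sum (λ d → s * (t d * A d zero j) * det (minor M j))
      ≡⟨ sum-cong-≗ step ⟩
    sum (λ d → t d * expansionTerm (A d) j)
      ∎
    where
    s = sign (toℕ j)
    same-minor : ∀ d → det (minor M j) ≡ det (minor (A d) j)
    same-minor d = det-cong (λ i l → sym (other-columns d (suc i) (punchIn j l) (Finₚ.punchInᵢ≢i j l)))
    step : ∀ d → s * (t d * A d zero j) * det (minor M j) ≡ t d * expansionTerm (A d) j
    step d rewrite same-minor d =
      solve 4 (λ s t a D → s :* (t :* a) :* D := t :* (s :* a :* D)) refl s (t d) (A d zero j) (det (minor (A d) j))
  ... | no j≢c = begin
    s * M zero j * det (minor M j)
      ≡⟨ cong (s * M zero j *_) minor-linear ⟩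
    s * M zero j * sum (λ d → t d * det (minor (A d) j))
      ≡⟨ *-distribˡ-sum (s * M zero j) (λ d → t d * det (minor (A d) j)) ⟩
    sum (λ d → s * M zero j * (t d * det (minor (A d) j)))
      ≡⟨ sum-cong-≗ step ⟩
    sum (λ d → t d * expansionTerm (A d) j)
      ∎
    where
    s = sign (toℕ j)
    c′ = Fin.punchOut j≢c
    minor-linear : det (minor M j) ≡ sum (λ d → t d * det (minor (A d) j))
    minor-linear = det-linearInColumn c′ t (λ d → minor (A d) j) (minor M j)
      (λ i → subst (λ l → M (suc i) l ≡ sum (λ d → t d * A d (suc i) l))
                   (sym (Finₚ.punchIn-punchOut j≢c)) (column-c (suc i)))
      (λ d i l l≢c′ → other-columns d (suc i) (punchIn j l)
         (λ eq → l≢c′ (Finₚ.punchIn-injective j l c′ (trans eq (sym (Finₚ.punchIn-punchOut j≢c))))))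
    step : ∀ d → s * M zero j * (t d * det (minor (A d) j)) ≡ t d * expansionTerm (A d) j
    step d rewrite other-columns d zero j j≢c =
      solve 4 (λ s a t D → s :* a :* (t :* D) := t :* (s :* a :* D)) refl s (M zero j) (t d) (det (minor (A d) j))

det-zeroColumn : ∀ {n} (M : Matrix n) (c : Fin n) → (∀ i → M i c ≡ 0ℚ) → det M ≡ 0ℚ
det-zeroColumn M c zero-column = det-linearInColumn {k = 0} c (λ ()) (λ ()) M zero-column (λ ())

-- Alternation

sign-suc : ∀ k → sign (suc k) ≡ - sign k
sign-suc 0       = refl
sign-suc (suc k) = trans (solve 1 (λ a → a := :- (:- a)) refl (sign k)) (cong -_ (sym (sign-suc k)))

transpose-ˡ : ∀ {n} (i j : Fin n) → transpose i j i ≡ j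
transpose-ˡ i j rewrite dec-true (i Fin.≟ i) refl = refl

transpose-ʳ : ∀ {n} (i j : Fin n) → transpose i j j ≡ i
transpose-ʳ i j with j Fin.≟ i
... | yes j≡i = j≡i
... | no  _   rewrite dec-true (j Fin.≟ j) refl = refl

transpose-fixes : ∀ {n} {i j k : Fin n} → k ≢ i → k ≢ j → transpose i j k ≡ k
transpose-fixes {i = i} {j} {k} k≢i k≢j rewrite dec-false (k Fin.≟ i) k≢i | dec-false (k Fin.≟ j) k≢j = refl

transpose-conjugate : ∀ {m n} (f : Fin m → Fin n) → (∀ {a b} → f a ≡ f b → a ≡ b) →
  ∀ a b k → transpose (f a) (f b) (f k) ≡ f (transpose a b k)
transpose-conjugate f f-injective a b k = by-cases (k Fin.≟ a) (k Fin.≟ b)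
  where
  by-cases : Dec (k ≡ a) → Dec (k ≡ b) → transpose (f a) (f b) (f k) ≡ f (transpose a b k)
  by-cases (yes refl) _          = trans (transpose-ˡ (f k) (f b)) (cong f (sym (transpose-ˡ k b)))
  by-cases (no k≢a)   (yes refl) = trans (transpose-ʳ (f a) (f k)) (cong f (sym (transpose-ʳ a k)))
  by-cases (no k≢a)   (no k≢b)   =
    trans (transpose-fixes (k≢a ∘ f-injective) (k≢b ∘ f-injective)) (cong f (sym (transpose-fixes k≢a k≢b)))

punchIn-adjacent : ∀ {n} (e l : Fin n) →
  punchIn (inject₁ e) l ≡ punchIn (suc e) l ⊎ (punchIn (inject₁ e) l ≡ suc e × punchIn (suc e) l ≡ inject₁ e)
punchIn-adjacent zero    zero    = inj₂ (refl , refl)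
punchIn-adjacent zero    (suc l) = inj₁ refl
punchIn-adjacent (suc e) zero    = inj₁ refl
punchIn-adjacent (suc e) (suc l) with punchIn-adjacent e l
... | inj₁ eq         = inj₁ (cong suc eq)
... | inj₂ (eq , eq′) = inj₂ (cong suc eq , cong suc eq′)

transpose-punchIn-adjacent : ∀ {n} (e l : Fin n) →
  transpose (inject₁ e) (suc e) (punchIn (inject₁ e) l) ≡ punchIn (suc e) l ×
  transpose (inject₁ e) (suc e) (punchIn (suc e) l) ≡ punchIn (inject₁ e) l
transpose-punchIn-adjacent e l with punchIn-adjacent e l
... | inj₁ eq = fixed , trans (cong σ (sym eq)) (trans fixed (sym eq))
  where
  σ = transpose (inject₁ e) (suc e)
  fixed : σ (punchIn (inject₁ e) l) ≡ punchIn (suc e) l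
  fixed = trans (transpose-fixes (Finₚ.punchInᵢ≢i (inject₁ e) l) (Finₚ.punchInᵢ≢i (suc e) l ∘ trans (sym eq))) eq
... | inj₂ (eq , eq′) =
  trans (cong σ eq)  (trans (transpose-ʳ (inject₁ e) (suc e)) (sym eq′)) ,
  trans (cong σ eq′) (trans (transpose-ˡ (inject₁ e) (suc e)) (sym eq))
  where
  σ = transpose (inject₁ e) (suc e)

punchIn-adjacent-minor : ∀ {n} (e : Fin (suc n)) (j : Fin (suc (suc n))) → j ≢ inject₁ e → j ≢ suc e →
  ∃ λ (e′ : Fin n) → punchIn j (inject₁ e′) ≡ inject₁ e × punchIn j (suc e′) ≡ suc e
punchIn-adjacent-minor         zero    zero          j≢c _   = ⊥-elim (j≢c refl)
punchIn-adjacent-minor         (suc e) zero          _   _   = e , refl , refl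
punchIn-adjacent-minor         zero    (suc zero)    _   j≢d = ⊥-elim (j≢d refl)
punchIn-adjacent-minor {suc n} zero    (suc (suc j)) _   _   = zero , refl , refl
punchIn-adjacent-minor {suc n} (suc e) (suc j)       j≢c j≢d
  with e′ , eq , eq′ ← punchIn-adjacent-minor e j (j≢c ∘ cong suc) (j≢d ∘ cong suc)
  = suc e′ , cong suc eq , cong suc eq′

swapColumns : ∀ {n} → Matrix n → Fin n → Fin n → Matrix n
swapColumns M a b i l = M i (transpose a b l)

expansionTerm-swapAdjacent : ∀ {n} (e : Fin n) (M : Matrix (suc n)) →
  let M′ = swapColumns M (inject₁ e) (suc e) in
  expansionTerm M′ (suc e) ≡ - expansionTerm M (inject₁ e) × expansionTerm M′ (inject₁ e) ≡ - expansionTerm M (suc e)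
expansionTerm-swapAdjacent e M = at-d , at-c
  where
  c = inject₁ e
  d = suc e
  M′ = swapColumns M c d
  sign-d : sign (toℕ d) ≡ - sign (toℕ c)
  sign-d = trans (sign-suc (toℕ e)) (cong (λ k → - sign k) (sym (Finₚ.toℕ-inject₁ e)))
  at-d : expansionTerm M′ d ≡ - expansionTerm M c
  at-d = begin
    sign (toℕ d) * M zero (transpose c d d) * det (minor M′ d)
      ≡⟨ cong₂ (λ s a → s * a * det (minor M′ d)) sign-d (cong (M zero) (transpose-ʳ c d)) ⟩
    - sign (toℕ c) * M zero c * det (minor M′ d)
      ≡⟨ cong (λ D → - sign (toℕ c) * M zero c * D)
              (det-cong λ i l → cong (M (suc i)) (proj₂ (transpose-punchIn-adjacent e l))) ⟩
    - sign (toℕ c) * M zero c * det (minor M c)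
      ≡⟨ solve 3 (λ s a D → (:- s) :* a :* D := :- (s :* a :* D)) refl (sign (toℕ c)) (M zero c) (det (minor M c)) ⟩
    - expansionTerm M c
      ∎
  at-c : expansionTerm M′ c ≡ - expansionTerm M d
  at-c = begin
    sign (toℕ c) * M zero (transpose c d c) * det (minor M′ c)
      ≡⟨ cong₂ (λ a D → sign (toℕ c) * a * D) (cong (M zero) (transpose-ˡ c d))
                 (det-cong λ i l → cong (M (suc i)) (proj₁ (transpose-punchIn-adjacent e l))) ⟩
    sign (toℕ c) * M zero d * det (minor M d)
      ≡⟨ solve 3 (λ s a D → s :* a :* D := :- ((:- s) :* a :* D)) refl (sign (toℕ c)) (M zero d) (det (minor M d)) ⟩
    - (- sign (toℕ c) * M zero d * det (minor M d))
      ≡⟨ cong (λ s → - (s * M zero d * det (minor M d))) sign-d ⟨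
    - expansionTerm M d
      ∎

det-swapAdjacentColumns : ∀ {n} (e : Fin n) (M : Matrix (suc n)) →
  det (swapColumns M (inject₁ e) (suc e)) ≡ - det M
det-swapAdjacentColumns {suc n} e M = begin
  det M′                           ≡⟨ det-expand M′ ⟩
  sum (expansionTerm M′)           ≡⟨ sum-permute (expansionTerm M′) (Perm.transpose c d) ⟩
  sum (expansionTerm M′ ∘ σ)       ≡⟨ sum-cong-≗ (λ j → swapped-term (j Fin.≟ c) (j Fin.≟ d)) ⟩
  sum (λ j → - expansionTerm M j)  ≡⟨ sum-neg (expansionTerm M) ⟩
  - sum (expansionTerm M)          ≡⟨ cong -_ (det-expand M) ⟨
  - det M                          ∎
  where
  c = inject₁ e
  d = suc e
  σ = transpose c d
  M′ = swapColumns M c d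
  swapped-term : ∀ {j} → Dec (j ≡ c) → Dec (j ≡ d) → expansionTerm M′ (σ j) ≡ - expansionTerm M j
  swapped-term (yes refl) _ =
    trans (cong (expansionTerm M′) (transpose-ˡ c d)) (proj₁ (expansionTerm-swapAdjacent e M))
  swapped-term (no _) (yes refl) =
    trans (cong (expansionTerm M′) (transpose-ʳ c d)) (proj₂ (expansionTerm-swapAdjacent e M))
  swapped-term {j} (no j≢c) (no j≢d) with e′ , c′ , d′ ← punchIn-adjacent-minor e j j≢c j≢d = begin
    expansionTerm M′ (σ j)
      ≡⟨ cong (expansionTerm M′) σj≡j ⟩
    sign (toℕ j) * M zero (σ j) * det (minor M′ j)
      ≡⟨ cong₂ (λ a D → sign (toℕ j) * a * D) (cong (M zero) σj≡j) (det-cong minor-swapped) ⟩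
    sign (toℕ j) * M zero j * det (swapColumns (minor M j) (inject₁ e′) (suc e′))
      ≡⟨ cong (sign (toℕ j) * M zero j *_) (det-swapAdjacentColumns e′ (minor M j)) ⟩
    sign (toℕ j) * M zero j * - det (minor M j)
      ≡⟨ solve 3 (λ s a D → s :* a :* (:- D) := :- (s :* a :* D)) refl (sign (toℕ j)) (M zero j) (det (minor M j)) ⟩
    - expansionTerm M j
      ∎
    where
    σj≡j : σ j ≡ j
    σj≡j = transpose-fixes j≢c j≢d
    minor-swapped : ∀ i l → minor M′ j i l ≡ swapColumns (minor M j) (inject₁ e′) (suc e′) i l
    minor-swapped i l = cong (M (suc i)) (begin
      σ (punchIn j l)
        ≡⟨ cong₂ (λ a b → transpose a b (punchIn j l)) c′ d′ ⟨
      transpose (punchIn j (inject₁ e′)) (punchIn j (suc e′)) (punchIn j l)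
        ≡⟨ transpose-conjugate (punchIn j) (Finₚ.punchIn-injective j _ _) (inject₁ e′) (suc e′) l ⟩
      punchIn j (transpose (inject₁ e′) (suc e′) l)
        ∎)

swapColumns-equal : ∀ {n} (M : Matrix n) {a b} → (∀ i → M i a ≡ M i b) → ∀ i l → swapColumns M a b i l ≡ M i l
swapColumns-equal M {a} {b} equal i l = by-cases (l Fin.≟ a) (l Fin.≟ b)
  where
  by-cases : Dec (l ≡ a) → Dec (l ≡ b) → M i (transpose a b l) ≡ M i l
  by-cases (yes refl) _          = trans (cong (M i) (transpose-ˡ l b)) (sym (equal i))
  by-cases (no _)     (yes refl) = trans (cong (M i) (transpose-ʳ a l)) (equal i)
  by-cases (no l≢a)   (no l≢b)   = cong (M i) (transpose-fixes l≢a l≢b)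

det-equalAdjacentColumns : ∀ {n} (e : Fin n) (M : Matrix (suc n)) →
  (∀ i → M i (inject₁ e) ≡ M i (suc e)) → det M ≡ 0ℚ
det-equalAdjacentColumns e M equal = ≡-neg⇒≡0 (begin
  det M                                    ≡⟨ det-cong (swapColumns-equal M equal) ⟨
  det (swapColumns M (inject₁ e) (suc e))  ≡⟨ det-swapAdjacentColumns e M ⟩
  - det M                                  ∎)

det-equalColumns-atDistance : ∀ k {n} (M : Matrix n) {c d : Fin n} → suc (toℕ c ℕ.+ k) ≡ toℕ d →
  (∀ i → M i c ≡ M i d) → det M ≡ 0ℚ
det-equalColumns-atDistance 0 M {c} {suc e} distance equal =
  det-equalAdjacentColumns e M (λ i → trans (cong (M i) (sym c≡e)) (equal i))
  where
  c≡e : c ≡ inject₁ e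
  c≡e = Finₚ.toℕ-injective (trans (sym (ℕₚ.+-identityʳ (toℕ c)))
                           (trans (ℕₚ.suc-injective distance) (sym (Finₚ.toℕ-inject₁ e))))
det-equalColumns-atDistance (suc k) M {c} {suc e} distance equal =
  neg≡0⇒≡0 (trans (sym (det-swapAdjacentColumns e M)) (det-equalColumns-atDistance k M′ distance′ equal′))
  where
  M′ = swapColumns M (inject₁ e) (suc e)
  c+1+k≡e : toℕ c ℕ.+ suc k ≡ toℕ e
  c+1+k≡e = ℕₚ.suc-injective distance
  distance′ : suc (toℕ c ℕ.+ k) ≡ toℕ (inject₁ e)
  distance′ = trans (sym (ℕₚ.+-suc (toℕ c) k)) (trans c+1+k≡e (sym (Finₚ.toℕ-inject₁ e)))
  c≢e : c ≢ inject₁ e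
  c≢e eq = ℕₚ.m+1+n≢m (toℕ c) (trans c+1+k≡e (trans (sym (Finₚ.toℕ-inject₁ e)) (cong toℕ (sym eq))))
  c≢d : c ≢ suc e
  c≢d eq = ℕₚ.m≢1+m+n (toℕ c) (trans (cong toℕ eq) (cong suc (sym c+1+k≡e)))
  equal′ : ∀ i → M′ i c ≡ M′ i (inject₁ e)
  equal′ i = begin
    M i (transpose (inject₁ e) (suc e) c)            ≡⟨ cong (M i) (transpose-fixes c≢e c≢d) ⟩
    M i c                                            ≡⟨ equal i ⟩
    M i (suc e)                                      ≡⟨ cong (M i) (transpose-ˡ (inject₁ e) (suc e)) ⟨
    M i (transpose (inject₁ e) (suc e) (inject₁ e))  ∎

det-equalColumns : ∀ {n} (M : Matrix n) {c d : Fin n} → c ≢ d → (∀ i → M i c ≡ M i d) → det M ≡ 0ℚ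
det-equalColumns M {c} {d} c≢d equal with ℕₚ.<-cmp (toℕ c) (toℕ d)
... | tri< c<d _ _ = det-equalColumns-atDistance _ M (proj₂ (ℕₚ.m≤n⇒∃[o]m+o≡n c<d)) equal
... | tri≈ _ c≡d _ = ⊥-elim (c≢d (Finₚ.toℕ-injective c≡d))
... | tri> _ _ d<c = det-equalColumns-atDistance _ M (proj₂ (ℕₚ.m≤n⇒∃[o]m+o≡n d<c)) (sym ∘ equal)

replaceColumn : ∀ {n} → Matrix n → Fin n → (Fin n → ℚ) → Matrix n
replaceColumn M c v i l = if does (l Fin.≟ c) then v i else M i l

replaceColumn-at : ∀ {n} (M : Matrix n) c v i → replaceColumn M c v i c ≡ v i
replaceColumn-at M c v i rewrite dec-true (c Fin.≟ c) refl = refl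

replaceColumn-other : ∀ {n} (M : Matrix n) {c l} v i → l ≢ c → replaceColumn M c v i l ≡ M i l
replaceColumn-other M {c} {l} v i l≢c rewrite dec-false (l Fin.≟ c) l≢c = refl

det-addColumnCombination : ∀ {n k} (M M′ : Matrix n) (c : Fin n) (t : Fin k → ℚ) (src : Fin k → Fin n) →
  (∀ d → src d ≢ c) →
  (∀ i → M′ i c ≡ M i c + sum (λ d → t d * M i (src d))) →
  (∀ i l → l ≢ c → M′ i l ≡ M i l) →
  det M′ ≡ det M
det-addColumnCombination {k = k} M M′ c t src src≢c column-c other-columns = begin
  det M′                                          ≡⟨ det-linearInColumn c coefficient A M′ combination agree ⟩
  1ℚ * det M + sum (λ d → t d * det (A (suc d)))  ≡⟨ cong (1ℚ * det M +_) (sum-zero vanishing) ⟩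
  1ℚ * det M + 0ℚ                                 ≡⟨ solve 1 (λ x → con 1ℚ :* x :+ con 0ℚ := x) refl (det M) ⟩
  det M                                           ∎
  where
  coefficient : Fin (suc k) → ℚ
  coefficient zero    = 1ℚ
  coefficient (suc d) = t d
  column : Fin k → Fin _ → ℚ
  column d i = M i (src d)
  A : Fin (suc k) → Matrix _
  A zero    = M
  A (suc d) = replaceColumn M c (column d)
  combination : ∀ i → M′ i c ≡ sum (λ d → coefficient d * A d i c)
  combination i = trans (column-c i) (cong₂ _+_ (sym (ℚₚ.*-identityˡ (M i c)))
    (sum-cong-≗ λ d → cong (t d *_) (sym (replaceColumn-at M c (column d) i))))
  agree : ∀ d i l → l ≢ c → A d i l ≡ M′ i l
  agree zero    i l l≢c = sym (other-columns i l l≢c)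
  agree (suc d) i l l≢c = trans (replaceColumn-other M (column d) i l≢c) (sym (other-columns i l l≢c))
  vanishing : ∀ d → t d * det (A (suc d)) ≡ 0ℚ
  vanishing d = trans (cong (t d *_) singular) (ℚₚ.*-zeroʳ (t d))
    where
    singular : det (A (suc d)) ≡ 0ℚ
    singular = det-equalColumns (A (suc d)) (src≢c d ∘ sym)
      (λ i → trans (replaceColumn-at M c (column d) i) (sym (replaceColumn-other M (column d) i (src≢c d))))

mixColumns : ∀ {n} → ℕ → Matrix n → Matrix n → Matrix n
mixColumns m M M′ i l with toℕ l ℕ.<? m
... | yes _ = M′ i l
... | no  _ = M i l

mixColumns-< : ∀ {n m} (M M′ : Matrix n) i l → toℕ l ℕ.< m → mixColumns m M M′ i l ≡ M′ i l
mixColumns-< {m = m} M M′ i l l<m with toℕ l ℕ.<? m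
... | yes _   = refl
... | no  l≮m = ⊥-elim (l≮m l<m)

mixColumns-≮ : ∀ {n m} (M M′ : Matrix n) i l → ¬ toℕ l ℕ.< m → mixColumns m M M′ i l ≡ M i l
mixColumns-≮ {m = m} M M′ i l l≮m with toℕ l ℕ.<? m
... | yes l<m = ⊥-elim (l≮m l<m)
... | no  _   = refl

mixColumns-agree : ∀ {n m} (M M′ : Matrix n) i l → M′ i l ≡ M i l → mixColumns m M M′ i l ≡ M i l
mixColumns-agree {m = m} M M′ i l M′≡M with toℕ l ℕ.<? m
... | yes _ = M′≡M
... | no  _ = refl

mixColumns-suc : ∀ {n m} (M M′ : Matrix n) {c} → toℕ c ≡ m → ∀ i l → l ≢ c →
  mixColumns (suc m) M M′ i l ≡ mixColumns m M M′ i l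
mixColumns-suc {m = m} M M′ {c} toℕ-c i l l≢c = by-cases (toℕ l ℕ.<? m)
  where
  by-cases : Dec (toℕ l ℕ.< m) → mixColumns (suc m) M M′ i l ≡ mixColumns m M M′ i l
  by-cases (yes l<m) = trans (mixColumns-< M M′ i l (ℕₚ.m<n⇒m<1+n l<m)) (sym (mixColumns-< M M′ i l l<m))
  by-cases (no  l≮m) = trans (mixColumns-≮ M M′ i l l≮1+m) (sym (mixColumns-≮ M M′ i l l≮m))
    where
    l≮1+m : ¬ toℕ l ℕ.< suc m
    l≮1+m l<1+m =
      l≢c (Finₚ.toℕ-injective (trans (ℕₚ.≤-antisym (ℕ.s≤s⁻¹ l<1+m) (ℕₚ.≮⇒≥ l≮m)) (sym toℕ-c)))

↑ˡ≢↑ʳ : ∀ {a b} (j : Fin a) (k : Fin b) → j ↑ˡ b ≢ a ↑ʳ k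
↑ˡ≢↑ʳ {a} {b} j k eq
  with () ← trans (sym (Finₚ.splitAt-↑ˡ a j b)) (trans (cong (Fin.splitAt a) eq) (Finₚ.splitAt-↑ʳ a b k))

det-addColumnCombinations : ∀ a {b} (M M′ : Matrix (a ℕ.+ b)) (T : Fin a → Fin b → ℚ) →
  (∀ i j → M′ i (j ↑ˡ b) ≡ M i (j ↑ˡ b) + sum (λ k → T j k * M i (a ↑ʳ k))) →
  (∀ i k → M′ i (a ↑ʳ k) ≡ M i (a ↑ʳ k)) →
  det M′ ≡ det M
det-addColumnCombinations a {b} M M′ T left-columns right-columns = begin
  det M′            ≡⟨ det-cong all-updated ⟨
  det (partial a)   ≡⟨ det-partial a ℕₚ.≤-refl ⟩
  det M             ∎
  where
  partial : ℕ → Matrix (a ℕ.+ b)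
  partial m = mixColumns m M M′
  partial-right : ∀ m i k → partial m i (a ↑ʳ k) ≡ M i (a ↑ʳ k)
  partial-right m i k = mixColumns-agree {m = m} M M′ i (a ↑ʳ k) (right-columns i k)
  all-updated : ∀ i l → partial a i l ≡ M′ i l
  all-updated i l with Fin.splitAt a l in eq
  ... | inj₂ k rewrite sym (Finₚ.splitAt⁻¹-↑ʳ eq) = trans (partial-right a i k) (sym (right-columns i k))
  ... | inj₁ j rewrite sym (Finₚ.splitAt⁻¹-↑ˡ eq) =
    mixColumns-< M M′ i (j ↑ˡ b) (subst (ℕ._< a) (sym (Finₚ.toℕ-↑ˡ j b)) (Finₚ.toℕ<n j))
  step : ∀ m (m<a : m ℕ.< a) → det (partial (suc m)) ≡ det (partial m)
  step m m<a = det-addColumnCombination (partial m) (partial (suc m)) c (T j) (a ↑ʳ_)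
    (λ k eq → ↑ˡ≢↑ʳ j k (sym eq)) column-c (mixColumns-suc M M′ toℕ-c)
    where
    j = fromℕ< m<a
    c = j ↑ˡ b
    toℕ-c : toℕ c ≡ m
    toℕ-c = trans (Finₚ.toℕ-↑ˡ j b) (Finₚ.toℕ-fromℕ< m<a)
    column-c : ∀ i → partial (suc m) i c ≡ partial m i c + sum (λ k → T j k * partial m i (a ↑ʳ k))
    column-c i = begin
      partial (suc m) i c
        ≡⟨ mixColumns-< M M′ i c (ℕₚ.≤-reflexive (cong suc toℕ-c)) ⟩
      M′ i c
        ≡⟨ left-columns i j ⟩
      M i c + sum (λ k → T j k * M i (a ↑ʳ k))
        ≡⟨ cong₂ _+_ (mixColumns-≮ M M′ i c (ℕₚ.<-irrefl toℕ-c))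
                     (sum-cong-≗ λ k → cong (T j k *_) (partial-right m i k)) ⟨
      partial m i c + sum (λ k → T j k * partial m i (a ↑ʳ k))
        ∎
  det-partial : ∀ m → m ℕ.≤ a → det (partial m) ≡ det M
  det-partial 0       _     = det-cong λ i l → mixColumns-≮ {m = 0} M M′ i l λ ()
  det-partial (suc m) 1+m≤a = trans (step m 1+m≤a) (det-partial m (ℕₚ.<⇒≤ 1+m≤a))

-- Block structure

toℕ-punchIn-≤ : ∀ {n} (j : Fin (suc n)) (l : Fin n) → toℕ (punchIn j l) ℕ.≤ suc (toℕ l)
toℕ-punchIn-≤ zero    l       = ℕₚ.≤-refl
toℕ-punchIn-≤ (suc j) zero    = ℕ.z≤n
toℕ-punchIn-≤ (suc j) (suc l) = ℕ.s≤s (toℕ-punchIn-≤ j l)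

toℕ-punchIn-< : ∀ {n} (j : Fin (suc n)) (l : Fin n) → toℕ l ℕ.< toℕ j → toℕ (punchIn j l) ≡ toℕ l
toℕ-punchIn-< (suc j) zero    _           = refl
toℕ-punchIn-< (suc j) (suc l) (ℕ.s≤s l<j) = cong suc (toℕ-punchIn-< j l l<j)

punchIn-↑ˡ : ∀ {a} b (j : Fin (suc a)) (l : Fin a) → punchIn (j ↑ˡ b) (l ↑ˡ b) ≡ punchIn j l ↑ˡ b
punchIn-↑ˡ b zero    l       = refl
punchIn-↑ˡ b (suc j) zero    = refl
punchIn-↑ˡ b (suc j) (suc l) = cong suc (punchIn-↑ˡ b j l)

punchIn-↑ʳ : ∀ {a b} (j : Fin (suc a)) (l : Fin b) → punchIn (j ↑ˡ b) (a ↑ʳ l) ≡ suc a ↑ʳ l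
punchIn-↑ʳ         zero    l = refl
punchIn-↑ʳ {suc a} (suc j) l = cong suc (punchIn-↑ʳ j l)

det-vanishingCorner : ∀ {n} k (M : Matrix n) → k ℕ.< n →
  (∀ i j → k ℕ.≤ toℕ i → toℕ j ℕ.≤ k → M i j ≡ 0ℚ) → det M ≡ 0ℚ
det-vanishingCorner {suc n} 0       M _   corner = det-zeroColumn M zero (λ i → corner i zero ℕ.z≤n ℕ.z≤n)
det-vanishingCorner {suc n} (suc k) M k<n corner = trans (det-expand M) (sum-zero vanishing-term)
  where
  vanishing-term : ∀ j → expansionTerm M j ≡ 0ℚ
  vanishing-term j = trans (cong (sign (toℕ j) * M zero j *_) minor-singular) (ℚₚ.*-zeroʳ (sign (toℕ j) * M zero j))
    where
    minor-singular : det (minor M j) ≡ 0ℚ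
    minor-singular = det-vanishingCorner k (minor M j) (ℕ.s≤s⁻¹ k<n)
      (λ i l k≤i l≤k → corner (suc i) (punchIn j l) (ℕ.s≤s k≤i)
                              (ℕₚ.≤-trans (toℕ-punchIn-≤ j l) (ℕ.s≤s l≤k)))

det-minor-rightBlock : ∀ a {b} (M : Matrix (suc a ℕ.+ b)) → (∀ i j → M (suc a ↑ʳ i) (j ↑ˡ b) ≡ 0ℚ) →
  ∀ j → det (minor M (suc a ↑ʳ j)) ≡ 0ℚ
det-minor-rightBlock a {b} M lower-left j = det-vanishingCorner a (minor M (suc a ↑ʳ j)) a<a+b corner
  where
  a<toℕ-j : a ℕ.< toℕ (suc a ↑ʳ j)
  a<toℕ-j = ℕₚ.≤-trans (ℕₚ.m≤m+n (suc a) (toℕ j)) (ℕₚ.≤-reflexive (sym (Finₚ.toℕ-↑ʳ (suc a) j)))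
  a<a+b : a ℕ.< a ℕ.+ b
  a<a+b = ℕₚ.<-≤-trans a<toℕ-j (ℕ.s≤s⁻¹ (Finₚ.toℕ<n (suc a ↑ʳ j)))
  corner : ∀ i l → a ℕ.≤ toℕ i → toℕ l ℕ.≤ a → minor M (suc a ↑ʳ j) i l ≡ 0ℚ
  corner i l a≤i l≤a = trans (cong₂ M (sym (Finₚ.splitAt⁻¹-↑ʳ (Finₚ.splitAt-≥ (suc a) (suc i) (ℕ.s≤s a≤i))))
                                       (sym (Finₚ.splitAt⁻¹-↑ˡ (Finₚ.splitAt-< (suc a) p p<1+a))))
                             (lower-left _ _)
    where
    p = punchIn (suc a ↑ʳ j) l
    p<1+a : toℕ p ℕ.< suc a
    p<1+a = ℕ.s≤s (subst (ℕ._≤ a) (sym (toℕ-punchIn-< (suc a ↑ʳ j) l (ℕₚ.≤-<-trans l≤a a<toℕ-j))) l≤a)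

det-blockUpperTriangular : ∀ a {b} (M : Matrix (a ℕ.+ b)) → (∀ i j → M (a ↑ʳ i) (j ↑ˡ b) ≡ 0ℚ) →
  det M ≡ det (λ i j → M (i ↑ˡ b) (j ↑ˡ b)) * det (λ i j → M (a ↑ʳ i) (a ↑ʳ j))
det-blockUpperTriangular 0           M _          = sym (ℚₚ.*-identityˡ (det M))
det-blockUpperTriangular (suc a) {b} M lower-left = begin
  det M
    ≡⟨ det-expand M ⟩
  sum (expansionTerm M)
    ≡⟨ sum-↑ (suc a) (expansionTerm M) ⟩
  sum (λ j → expansionTerm M (j ↑ˡ b)) + sum (λ j → expansionTerm M (suc a ↑ʳ j))
    ≡⟨ cong₂ _+_ (sum-cong-≗ left-term) (sum-zero right-term) ⟩
  sum (λ j → expansionTerm A j * det D) + 0ℚ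
    ≡⟨ ℚₚ.+-identityʳ _ ⟩
  sum (λ j → expansionTerm A j * det D)
    ≡⟨ *-distribʳ-sum (det D) (expansionTerm A) ⟨
  sum (expansionTerm A) * det D
    ≡⟨ cong (_* det D) (det-expand A) ⟨
  det A * det D
    ∎
  where
  A = λ i j → M (i ↑ˡ b) (j ↑ˡ b)
  D = λ i j → M (suc a ↑ʳ i) (suc a ↑ʳ j)
  left-term : ∀ j → expansionTerm M (j ↑ˡ b) ≡ expansionTerm A j * det D
  left-term j = begin
    sign (toℕ (j ↑ˡ b)) * A zero j * det (minor M (j ↑ˡ b))
      ≡⟨ cong₂ (λ k d → sign k * A zero j * d) (Finₚ.toℕ-↑ˡ j b) minor-split ⟩
    sign (toℕ j) * A zero j * (det (minor A j) * det D)
      ≡⟨ solve 4 (λ s x y z → s :* x :* (y :* z) := s :* x :* y :* z) refl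
                 (sign (toℕ j)) (A zero j) (det (minor A j)) (det D) ⟩
    expansionTerm A j * det D
      ∎
    where
    minor-split : det (minor M (j ↑ˡ b)) ≡ det (minor A j) * det D
    minor-split = trans
      (det-blockUpperTriangular a (minor M (j ↑ˡ b))
        (λ i l → trans (cong (M (suc a ↑ʳ i)) (punchIn-↑ˡ b j l)) (lower-left i (punchIn j l))))
      (cong₂ _*_ (det-cong λ i l → cong (M (suc i ↑ˡ b)) (punchIn-↑ˡ b j l))
                 (det-cong λ i l → cong (M (suc a ↑ʳ i)) (punchIn-↑ʳ j l)))
  right-term : ∀ j → expansionTerm M (suc a ↑ʳ j) ≡ 0ℚ
  right-term j = trans (cong (s * M zero (suc a ↑ʳ j) *_) (det-minor-rightBlock a M lower-left j))
                       (ℚₚ.*-zeroʳ (s * M zero (suc a ↑ʳ j)))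
    where
    s = sign (toℕ (suc a ↑ʳ j))

det-blockElimination : ∀ a {b} (M : Matrix (a ℕ.+ b)) (T : Fin a → Fin b → ℚ) →
  (∀ i j → M (a ↑ʳ i) (j ↑ˡ b) + sum (λ k → T j k * M (a ↑ʳ i) (a ↑ʳ k)) ≡ 0ℚ) →
  det M ≡ det (λ i j → M (i ↑ˡ b) (j ↑ˡ b) + sum (λ k → T j k * M (i ↑ˡ b) (a ↑ʳ k)))
        * det (λ i j → M (a ↑ʳ i) (a ↑ʳ j))
det-blockElimination a {b} M T lower-left-vanishes = begin
  det M
    ≡⟨ det-addColumnCombinations a M M′ T left right ⟨
  det M′
    ≡⟨ det-blockUpperTriangular a M′ (λ i j → trans (left (a ↑ʳ i) j) (lower-left-vanishes i j)) ⟩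
  det (λ i j → M′ (i ↑ˡ b) (j ↑ˡ b)) * det (λ i j → M′ (a ↑ʳ i) (a ↑ʳ j))
    ≡⟨ cong₂ _*_ (det-cong λ i j → left (i ↑ˡ b) j) (det-cong λ i j → right (a ↑ʳ i) j) ⟩
  det (λ i j → combined (i ↑ˡ b) j) * det (λ i j → M (a ↑ʳ i) (a ↑ʳ j))
    ∎
  where
  combined : Fin (a ℕ.+ b) → Fin a → ℚ
  combined i j = M i (j ↑ˡ b) + sum (λ k → T j k * M i (a ↑ʳ k))
  M′ : Matrix (a ℕ.+ b)
  M′ i l = [ combined i , (λ k → M i (a ↑ʳ k)) ]′ (Fin.splitAt a l)
  left : ∀ i j → M′ i (j ↑ˡ b) ≡ combined i j
  left i j = cong [ combined i , (λ k → M i (a ↑ʳ k)) ]′ (Finₚ.splitAt-↑ˡ a j b)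
  right : ∀ i k → M′ i (a ↑ʳ k) ≡ M i (a ↑ʳ k)
  right i k = cong [ combined i , (λ k → M i (a ↑ʳ k)) ]′ (Finₚ.splitAt-↑ʳ a b k)

det-blockDiagonal : ∀ m {n} (S : Matrix (m ℕ.* n)) (B : Matrix n) →
  (∀ (k : Fin m) w (k′ : Fin m) w′ →
     S (combine k w) (combine k′ w′) ≡ (if does (k Fin.≟ k′) then B w w′ else 0ℚ)) →
  det S ≡ det B ^ m
det-blockDiagonal 0           S B blocks = refl
det-blockDiagonal (suc m) {n} S B blocks = trans (det-blockUpperTriangular n S lower-left)
  (cong₂ _*_ (det-cong λ w w′ → blocks zero w zero w′)
             (det-blockDiagonal m (λ i j → S (n ↑ʳ i) (n ↑ʳ j)) B λ k w k′ w′ → blocks (suc k) w (suc k′) w′))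
  where
  lower-left : ∀ i w → S (n ↑ʳ i) (w ↑ˡ (m ℕ.* n)) ≡ 0ℚ
  lower-left i w = trans (cong (λ i → S (n ↑ʳ i) (w ↑ˡ (m ℕ.* n))) (sym (Finₚ.combine-remQuot {m} n i)))
                         (blocks (suc (proj₁ (remQuot {m} n i))) (proj₂ (remQuot {m} n i)) zero w)

sumList : List ℚ → ℚ
sumList = List.foldr _+_ 0ℚ

sum-lookup : ∀ {A : Set} (xs : List A) (g : A → ℚ) → sum (g ∘ List.lookup xs) ≡ sumList (List.map g xs)
sum-lookup []       g = refl
sum-lookup (x ∷ xs) g = cong (g x +_) (sum-lookup xs g)

sumList-filter : ∀ {A : Set} (P : A → Bool) (xs : List A) (g : A → ℚ) →
  sumList (List.map g (List.filter (T? ∘ P) xs)) ≡ sumList (List.map (λ a → indicator (P a) * g a) xs)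
sumList-filter P []       g = refl
sumList-filter P (x ∷ xs) g with P x
... | true  = cong₂ _+_ (sym (ℚₚ.*-identityˡ (g x))) (sumList-filter P xs g)
... | false = trans (sumList-filter P xs g) (sym (trans (cong (_+ _) (ℚₚ.*-zeroˡ (g x))) (ℚₚ.+-identityˡ _)))

sumList-++ : ∀ xs ys → sumList (xs List.++ ys) ≡ sumList xs + sumList ys
sumList-++ []       ys = sym (ℚₚ.+-identityˡ (sumList ys))
sumList-++ (x ∷ xs) ys = trans (cong (x +_) (sumList-++ xs ys)) (sym (ℚₚ.+-assoc x _ _))

sumList-concatMap : ∀ {A B : Set} (f : A → List B) (xs : List A) (g : B → ℚ) →
  sumList (List.map g (List.concatMap f xs)) ≡ sumList (List.map (λ a → sumList (List.map g (f a))) xs)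
sumList-concatMap f []       g = refl
sumList-concatMap f (x ∷ xs) g = begin
  sumList (List.map g (f x List.++ List.concatMap f xs))
    ≡⟨ cong sumList (Listₚ.map-++ g (f x) _) ⟩
  sumList (List.map g (f x) List.++ List.map g (List.concatMap f xs))
    ≡⟨ sumList-++ (List.map g (f x)) _ ⟩
  sumList (List.map g (f x)) + sumList (List.map g (List.concatMap f xs))
    ≡⟨ cong (sumList (List.map g (f x)) +_) (sumList-concatMap f xs g) ⟩
  sumList (List.map (λ a → sumList (List.map g (f a))) (x ∷ xs))
    ∎

sumList-tabulate : ∀ {A : Set} {n} (f : Fin n → A) (g : A → ℚ) → sumList (List.map g (List.tabulate f)) ≡ sum (g ∘ f)
sumList-tabulate {n = 0}     f g = refl
sumList-tabulate {n = suc n} f g = cong (g (f zero) +_) (sumList-tabulate (f ∘ suc) g)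

sum-arcs : ∀ {n} (D : Digraph n) (g : Fin n × Fin n → ℚ) →
  sum (λ k → g (arcAt D k)) ≡ sum (λ u → sum (λ v → adjacency D u v * g (u , v)))
sum-arcs {n} D g = begin
  sum (λ k → g (arcAt D k))
    ≡⟨ sum-lookup (arcList D) g ⟩
  sumList (List.map g (arcList D))
    ≡⟨ sumList-filter (uncurry (arc D)) (List.concatMap row (List.allFin n)) g ⟩
  sumList (List.map G (List.concatMap row (List.allFin n)))
    ≡⟨ sumList-concatMap row (List.allFin n) G ⟩
  sumList (List.map (λ u → sumList (List.map G (row u))) (List.allFin n))
    ≡⟨ sumList-tabulate (λ u → u) (λ u → sumList (List.map G (row u))) ⟩
  sum (λ u → sumList (List.map G (row u)))
    ≡⟨ sum-cong-≗ (λ u → trans (cong (sumList ∘ List.map G) (Listₚ.map-tabulate (λ v → v) (u ,_)))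
                               (sumList-tabulate (u ,_) G)) ⟩
  sum (λ u → sum (λ v → adjacency D u v * g (u , v)))
    ∎
  where
  G : Fin n × Fin n → ℚ
  G p = indicator (uncurry (arc D) p) * g p
  row : Fin n → List (Fin n × Fin n)
  row u = List.map (u ,_) (List.allFin n)

outdeg-sum : ∀ {n} (D : Digraph n) u → ℕtoℚ (outdeg D u) ≡ sum (adjacency D u)
outdeg-sum D u = trans (ℕtoℚ-Σℕ (λ v → if arc D u v then 1 else 0)) (sum-cong-≗ λ v → ℕtoℚ-indicator (arc D u v))

sum-arcs-from : ∀ {n} (D : Digraph n) u → sum (λ k → δ u (proj₁ (arcAt D k))) ≡ ℕtoℚ (outdeg D u)
sum-arcs-from D u = begin
  sum (λ k → δ u (proj₁ (arcAt D k)))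
    ≡⟨ sum-arcs D (λ p → δ u (proj₁ p)) ⟩
  sum (λ u′ → sum (λ v → adjacency D u′ v * δ u u′))
    ≡⟨ sum-cong-≗ (λ u′ → *-distribʳ-sum (δ u u′) (adjacency D u′)) ⟨
  sum (λ u′ → sum (adjacency D u′) * δ u u′)
    ≡⟨ sum-δ u (λ u′ → sum (adjacency D u′)) ⟩
  sum (adjacency D u)
    ≡⟨ outdeg-sum D u ⟨
  ℕtoℚ (outdeg D u)
    ∎

sum-arcs-between : ∀ {n} (D : Digraph n) u v →
  sum (λ k → δ u (proj₁ (arcAt D k)) * δ v (proj₂ (arcAt D k))) ≡ adjacency D u v
sum-arcs-between D u v = begin
  sum (λ k → δ u (proj₁ (arcAt D k)) * δ v (proj₂ (arcAt D k)))
    ≡⟨ sum-arcs D (λ p → δ u (proj₁ p) * δ v (proj₂ p)) ⟩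
  sum (λ u′ → sum (λ v′ → adjacency D u′ v′ * (δ u u′ * δ v v′)))
    ≡⟨ sum-cong-≗ regroup ⟩
  sum (λ u′ → sum (λ v′ → adjacency D u′ v′ * δ v v′) * δ u u′)
    ≡⟨ sum-cong-≗ (λ u′ → cong (_* δ u u′) (sum-δ v (adjacency D u′))) ⟩
  sum (λ u′ → adjacency D u′ v * δ u u′)
    ≡⟨ sum-δ u (λ u′ → adjacency D u′ v) ⟩
  adjacency D u v
    ∎
  where
  regroup : ∀ u′ → sum (λ v′ → adjacency D u′ v′ * (δ u u′ * δ v v′)) ≡
                    sum (λ v′ → adjacency D u′ v′ * δ v v′) * δ u u′
  regroup u′ = trans
    (sum-cong-≗ λ v′ → solve 3 (λ a e f → a :* (e :* f) := a :* f :* e) refl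
                              (adjacency D u′ v′) (δ u u′) (δ v v′))
    (sym (*-distribʳ-sum (δ u u′) (λ v′ → adjacency D u′ v′ * δ v v′)))

numArcs-outRegular : ∀ {n r} (D : Digraph n) → OutRegular r D → numArcs D ≡ r ℕ.* n
numArcs-outRegular {n} {r} D regular = ℕtoℚ-injective (begin
  ℕtoℚ (numArcs D)                               ≡⟨ ℚₚ.*-identityʳ (ℕtoℚ (numArcs D)) ⟨
  ℕtoℚ (numArcs D) * 1ℚ                          ≡⟨ sum-const (numArcs D) 1ℚ ⟨
  sum (λ (k : Fin (numArcs D)) → 1ℚ)             ≡⟨ sum-arcs D (λ _ → 1ℚ) ⟩
  sum (λ u → sum (λ v → adjacency D u v * 1ℚ))   ≡⟨ sum-cong-≗ outdeg-u ⟩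
  sum (λ u → ℕtoℚ (outdeg D u))                  ≡⟨ sum-cong-≗ (cong ℕtoℚ ∘ regular) ⟩
  sum (λ (u : Fin n) → ℕtoℚ r)                   ≡⟨ sum-const n (ℕtoℚ r) ⟩
  ℕtoℚ n * ℕtoℚ r                                ≡⟨ ℕtoℚ-* n r ⟨
  ℕtoℚ (n ℕ.* r)                                 ≡⟨ cong ℕtoℚ (ℕₚ.*-comm n r) ⟩
  ℕtoℚ (r ℕ.* n)                                 ∎)
  where
  outdeg-u : ∀ u → sum (λ v → adjacency D u v * 1ℚ) ≡ ℕtoℚ (outdeg D u)
  outdeg-u u = trans (sum-cong-≗ λ v → ℚₚ.*-identityʳ (adjacency D u v)) (sym (outdeg-sum D u))

charMatrix : ∀ {n} → Matrix n → ℚ → Matrix n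
charMatrix M x i j = x * δ i j - M i j

charMatrix-laplacian : ∀ {n} (D : Digraph n) x i j →
  charMatrix (laplacian D) x i j ≡ (x - ℕtoℚ (outdeg D i)) * δ i j + adjacency D i j
charMatrix-laplacian D x i j =
  solve 4 (λ x d e a → x :* e :- (d :* e :- a) := (x :- d) :* e :+ a) refl x (ℕtoℚ (outdeg D i)) (δ i j) (adjacency D i j)

charMatrix-laplacian-rowSum : ∀ {n} (D : Digraph n) x u → sum (charMatrix (laplacian D) x u) ≡ x
charMatrix-laplacian-rowSum D x u = begin
  sum (charMatrix (laplacian D) x u)                  ≡⟨ sum-cong-≗ (charMatrix-laplacian D x u) ⟩
  sum (λ v → (x - d) * δ u v + adjacency D u v)       ≡⟨ ∑-distrib-+ (λ v → (x - d) * δ u v) (adjacency D u) ⟩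
  sum (λ v → (x - d) * δ u v) + sum (adjacency D u)   ≡⟨ cong₂ _+_ (sum-δ u (λ _ → x - d)) (sym (outdeg-sum D u)) ⟩
  (x - d) + d                                         ≡⟨ solve 2 (λ x d → (x :- d) :+ d := x) refl x d ⟩
  x                                                   ∎
  where
  d = ℕtoℚ (outdeg D u)

-- The forward-arc-corona

quotRem-combine : ∀ {m n} (k : Fin m) (w : Fin n) → Fin.quotRem {m} n (combine k w) ≡ (w , k)
quotRem-combine k w = cong swap (Finₚ.remQuot-combine k w)

module Corona {n₁ n₂} (D₁ : Digraph n₁) (D₂ : Digraph n₂) where

  C : Digraph (coronaSize D₁ D₂)
  C = corona D₁ D₂

  tailOf headOf : Fin (numArcs D₁) → Fin n₁
  tailOf k = proj₁ (arcAt D₁ k)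
  headOf k = proj₂ (arcAt D₁ k)

  inBase : Fin n₁ → Fin (coronaSize D₁ D₂)
  inBase u = u ↑ˡ (numArcs D₁ ℕ.* n₂)

  inCopy : Fin (numArcs D₁) → Fin n₂ → Fin (coronaSize D₁ D₂)
  inCopy k w = n₁ ↑ʳ combine k w

  decode-inBase : ∀ u → decode D₁ D₂ (inBase u) ≡ base u
  decode-inBase u rewrite Finₚ.splitAt-↑ˡ n₁ u (numArcs D₁ ℕ.* n₂) = refl

  decode-inCopy : ∀ k w → decode D₁ D₂ (inCopy k w) ≡ copy k w
  decode-inCopy k w rewrite Finₚ.splitAt-↑ʳ n₁ (numArcs D₁ ℕ.* n₂) (combine k w)
                          | quotRem-combine {numArcs D₁} k w = refl

  inCopy-injective : ∀ {k k′ w w′} → inCopy k w ≡ inCopy k′ w′ → k ≡ k′ × w ≡ w′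
  inCopy-injective eq = Finₚ.combine-injective _ _ _ _ (Finₚ.↑ʳ-injective n₁ _ _ eq)

  sum-corona : ∀ (f : Fin (coronaSize D₁ D₂) → ℚ) →
    sum f ≡ sum (f ∘ inBase) + sum (λ k → sum (λ w → f (inCopy k w)))
  sum-corona f = trans (sum-↑ n₁ f) (cong (sum (f ∘ inBase) +_) (sum-combine (numArcs D₁) (λ j → f (n₁ ↑ʳ j))))

  δ-inBase : ∀ u v → δ (inBase u) (inBase v) ≡ δ u v
  δ-inBase = δ-injective inBase (Finₚ.↑ˡ-injective _ _ _)

  δ-inCopy : ∀ k w k′ w′ → δ (inCopy k w) (inCopy k′ w′) ≡ (if does (k Fin.≟ k′) then δ w w′ else 0ℚ)
  δ-inCopy k w k′ w′ with k Fin.≟ k′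
  ... | yes refl = δ-injective (inCopy k) (proj₂ ∘ inCopy-injective) w w′
  ... | no  k≢k′ = δ-≢ (k≢k′ ∘ proj₁ ∘ inCopy-injective)

  adjacency-inBase : ∀ u v → adjacency C (inBase u) (inBase v) ≡ adjacency D₁ u v
  adjacency-inBase u v rewrite decode-inBase u | decode-inBase v = refl

  adjacency-inBase-inCopy : ∀ u k w → adjacency C (inBase u) (inCopy k w) ≡ δ u (tailOf k)
  adjacency-inBase-inCopy u k w rewrite decode-inBase u | decode-inCopy k w = refl

  adjacency-inCopy-inBase : ∀ k w v → adjacency C (inCopy k w) (inBase v) ≡ δ v (headOf k)
  adjacency-inCopy-inBase k w v rewrite decode-inCopy k w | decode-inBase v = refl

  adjacency-inCopy : ∀ k w k′ w′ →
    adjacency C (inCopy k w) (inCopy k′ w′) ≡ (if does (k Fin.≟ k′) then adjacency D₂ w w′ else 0ℚ)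
  adjacency-inCopy k w k′ w′ rewrite decode-inCopy k w | decode-inCopy k′ w′ with does (k Fin.≟ k′)
  ... | true  = refl
  ... | false = refl

  outdeg-inBase : ∀ u → ℕtoℚ (outdeg C (inBase u)) ≡ (1ℚ + ℕtoℚ n₂) * ℕtoℚ (outdeg D₁ u)
  outdeg-inBase u = begin
    ℕtoℚ (outdeg C (inBase u))
      ≡⟨ outdeg-sum C (inBase u) ⟩
    sum (adjacency C (inBase u))
      ≡⟨ sum-corona (adjacency C (inBase u)) ⟩
    sum (adjacency C (inBase u) ∘ inBase) + sum (λ k → sum (λ w → adjacency C (inBase u) (inCopy k w)))
      ≡⟨ cong₂ _+_ (sum-cong-≗ (adjacency-inBase u)) (sum-cong-≗ λ k → sum-cong-≗ (adjacency-inBase-inCopy u k)) ⟩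
    sum (adjacency D₁ u) + sum (λ k → sum (λ (w : Fin n₂) → δ u (tailOf k)))
      ≡⟨ cong₂ _+_ (sym (outdeg-sum D₁ u)) (sum-cong-≗ λ k → sum-const n₂ (δ u (tailOf k))) ⟩
    d + sum (λ k → ℕtoℚ n₂ * δ u (tailOf k))
      ≡⟨ cong (d +_) (trans (sym (*-distribˡ-sum (ℕtoℚ n₂) (λ k → δ u (tailOf k))))
                            (cong (ℕtoℚ n₂ *_) (sum-arcs-from D₁ u))) ⟩
    d + ℕtoℚ n₂ * d
      ≡⟨ solve 2 (λ d n → d :+ n :* d := (con 1ℚ :+ n) :* d) refl d (ℕtoℚ n₂) ⟩
    (1ℚ + ℕtoℚ n₂) * d
      ∎
    where
    d = ℕtoℚ (outdeg D₁ u)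

  outdeg-inCopy : ∀ k w → ℕtoℚ (outdeg C (inCopy k w)) ≡ 1ℚ + ℕtoℚ (outdeg D₂ w)
  outdeg-inCopy k w = begin
    ℕtoℚ (outdeg C (inCopy k w))
      ≡⟨ outdeg-sum C (inCopy k w) ⟩
    sum (adjacency C (inCopy k w))
      ≡⟨ sum-corona (adjacency C (inCopy k w)) ⟩
    sum (adjacency C (inCopy k w) ∘ inBase) + sum (λ k′ → sum (λ w′ → adjacency C (inCopy k w) (inCopy k′ w′)))
      ≡⟨ cong₂ _+_ (sum-cong-≗ (adjacency-inCopy-inBase k w))
                   (sum-cong-≗ λ k′ → sum-cong-≗ (adjacency-inCopy k w k′)) ⟩
    sum (λ v → δ v (headOf k)) + sum (λ k′ → sum (λ w′ → if does (k Fin.≟ k′) then adjacency D₂ w w′ else 0ℚ))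
      ≡⟨ cong₂ _+_ head copies ⟩
    1ℚ + ℕtoℚ (outdeg D₂ w)
      ∎
    where
    head : sum (λ v → δ v (headOf k)) ≡ 1ℚ
    head = trans (sum-cong-≗ λ v → trans (δ-sym v (headOf k)) (sym (ℚₚ.*-identityˡ _))) (sum-δ (headOf k) (λ _ → 1ℚ))
    copies : sum (λ k′ → sum (λ w′ → if does (k Fin.≟ k′) then adjacency D₂ w w′ else 0ℚ)) ≡
             ℕtoℚ (outdeg D₂ w)
    copies = begin
      sum (λ k′ → sum (λ w′ → if does (k Fin.≟ k′) then adjacency D₂ w w′ else 0ℚ))
        ≡⟨ sum-cong-≗ (λ k′ → trans (sum-if _ (adjacency D₂ w)) (if-δ k k′ _)) ⟩
      sum (λ k′ → sum (adjacency D₂ w) * δ k k′)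
        ≡⟨ sum-δ k (λ _ → sum (adjacency D₂ w)) ⟩
      sum (adjacency D₂ w)
        ≡⟨ outdeg-sum D₂ w ⟨
      ℕtoℚ (outdeg D₂ w)
        ∎

  module _ (x : ℚ) where

    χ : Matrix (coronaSize D₁ D₂)
    χ = charMatrix (laplacian C) x

    χ-inBase : ∀ u v →
      χ (inBase u) (inBase v) ≡ (x - (1ℚ + ℕtoℚ n₂) * ℕtoℚ (outdeg D₁ u)) * δ u v + adjacency D₁ u v
    χ-inBase u v = trans (charMatrix-laplacian C x (inBase u) (inBase v))
      (cong₂ _+_ (cong₂ (λ d e → (x - d) * e) (outdeg-inBase u) (δ-inBase u v)) (adjacency-inBase u v))

    χ-inBase-inCopy : ∀ u k w → χ (inBase u) (inCopy k w) ≡ δ u (tailOf k)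
    χ-inBase-inCopy u k w = begin
      χ (inBase u) (inCopy k w)
        ≡⟨ charMatrix-laplacian C x (inBase u) (inCopy k w) ⟩
      (x - d) * δ (inBase u) (inCopy k w) + adjacency C (inBase u) (inCopy k w)
        ≡⟨ cong₂ (λ e a → (x - d) * e + a) (δ-≢ (↑ˡ≢↑ʳ u (combine k w))) (adjacency-inBase-inCopy u k w) ⟩
      (x - d) * 0ℚ + δ u (tailOf k)
        ≡⟨ solve 2 (λ c a → c :* con 0ℚ :+ a := a) refl (x - d) (δ u (tailOf k)) ⟩
      δ u (tailOf k)
        ∎
      where
      d = ℕtoℚ (outdeg C (inBase u))

    χ-inCopy-inBase : ∀ k w v → χ (inCopy k w) (inBase v) ≡ δ v (headOf k)
    χ-inCopy-inBase k w v = begin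
      χ (inCopy k w) (inBase v)
        ≡⟨ charMatrix-laplacian C x (inCopy k w) (inBase v) ⟩
      (x - d) * δ (inCopy k w) (inBase v) + adjacency C (inCopy k w) (inBase v)
        ≡⟨ cong₂ (λ e a → (x - d) * e + a) (δ-≢ (↑ˡ≢↑ʳ v (combine k w) ∘ sym))
                                            (adjacency-inCopy-inBase k w v) ⟩
      (x - d) * 0ℚ + δ v (headOf k)
        ≡⟨ solve 2 (λ c a → c :* con 0ℚ :+ a := a) refl (x - d) (δ v (headOf k)) ⟩
      δ v (headOf k)
        ∎
      where
      d = ℕtoℚ (outdeg C (inCopy k w))

    χ-inCopy : ∀ k w k′ w′ →
      χ (inCopy k w) (inCopy k′ w′) ≡ (if does (k Fin.≟ k′) then charMatrix (laplacian D₂) (x - 1ℚ) w w′ else 0ℚ)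
    χ-inCopy k w k′ w′ = begin
      χ (inCopy k w) (inCopy k′ w′)
        ≡⟨ charMatrix-laplacian C x (inCopy k w) (inCopy k′ w′) ⟩
      (x - ℕtoℚ (outdeg C (inCopy k w))) * δ (inCopy k w) (inCopy k′ w′) + adjacency C (inCopy k w) (inCopy k′ w′)
        ≡⟨ cong₂ _+_ (cong₂ (λ d e → (x - d) * e) (outdeg-inCopy k w) (δ-inCopy k w k′ w′))
                     (adjacency-inCopy k w k′ w′) ⟩
      (x - (1ℚ + d)) * (if b then δ w w′ else 0ℚ) + (if b then adjacency D₂ w w′ else 0ℚ)
        ≡⟨ by-cases b ⟩
      (if b then charMatrix (laplacian D₂) (x - 1ℚ) w w′ else 0ℚ)
        ∎
      where
      b = does (k Fin.≟ k′)
      d = ℕtoℚ (outdeg D₂ w)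
      by-cases : ∀ b → (x - (1ℚ + d)) * (if b then δ w w′ else 0ℚ) + (if b then adjacency D₂ w w′ else 0ℚ)
                       ≡ (if b then charMatrix (laplacian D₂) (x - 1ℚ) w w′ else 0ℚ)
      by-cases true  = trans (solve 4 (λ x d e a → (x :- (con 1ℚ :+ d)) :* e :+ a := (x :- con 1ℚ :- d) :* e :+ a) refl
                                      x d (δ w w′) (adjacency D₂ w w′))
                             (sym (charMatrix-laplacian D₂ (x - 1ℚ) w w′))
      by-cases false = solve 2 (λ x d → (x :- (con 1ℚ :+ d)) :* con 0ℚ :+ con 0ℚ := con 0ℚ) refl x d

    sum-χ-inBase-inCopy : ∀ u k → sum (λ w → χ (inBase u) (inCopy k w)) ≡ ℕtoℚ n₂ * δ u (tailOf k)
    sum-χ-inBase-inCopy u k = trans (sum-cong-≗ (χ-inBase-inCopy u k)) (sum-const n₂ (δ u (tailOf k)))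

    sum-χ-inCopy : ∀ k′ w′ k → sum (λ w → χ (inCopy k′ w′) (inCopy k w)) ≡ (x - 1ℚ) * δ k′ k
    sum-χ-inCopy k′ w′ k = begin
      sum (λ w → χ (inCopy k′ w′) (inCopy k w))
        ≡⟨ sum-cong-≗ (χ-inCopy k′ w′ k) ⟩
      sum (λ w → if does (k′ Fin.≟ k) then χ₂ w′ w else 0ℚ)
        ≡⟨ sum-if (does (k′ Fin.≟ k)) (χ₂ w′) ⟩
      (if does (k′ Fin.≟ k) then sum (χ₂ w′) else 0ℚ)
        ≡⟨ if-δ k′ k (sum (χ₂ w′)) ⟩
      sum (χ₂ w′) * δ k′ k
        ≡⟨ cong (_* δ k′ k) (charMatrix-laplacian-rowSum D₂ (x - 1ℚ) w′) ⟩
      (x - 1ℚ) * δ k′ k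
        ∎
      where
      χ₂ = charMatrix (laplacian D₂) (x - 1ℚ)

-- Proved as a polynomial identity in ι = 1/(x − 1) and κ = 1/(x − s), modulo (x − 1)·ι = 1 and (x − s)·κ = 1.
base-entry-identity : ∀ x s n R p e a .{{_ : NonZero (x - 1ℚ)}} .{{_ : NonZero (x - s)}} → s ≡ 1ℚ + n → p ≡ R * n →
  (x - (1ℚ + n) * R) * e + a + - (1/ (x - 1ℚ)) * (n * a) ≡
  ((x - s) ÷ (x - 1ℚ)) * (((x * x - (p + 1ℚ) * x) ÷ (x - s) - R) * e + a)
base-entry-identity x s n R p e a refl refl = sym (begin
  (x - s) * ι * (((x * x - (R * n + 1ℚ) * x) * κ - R) * e + a)
    ≡⟨ polynomial-identity ⟩
  lhs + ((x - 1ℚ) * ι - 1ℚ) * P + ((x - s) * κ - 1ℚ) * Q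
    ≡⟨ cong₂ (λ c d → lhs + (c - 1ℚ) * P + (d - 1ℚ) * Q) (ℚₚ.*-inverseʳ (x - 1ℚ)) (ℚₚ.*-inverseʳ (x - s)) ⟩
  lhs + (1ℚ - 1ℚ) * P + (1ℚ - 1ℚ) * Q
    ≡⟨ solve 3 (λ l P Q → l :+ (con 1ℚ :- con 1ℚ) :* P :+ (con 1ℚ :- con 1ℚ) :* Q := l) refl lhs P Q ⟩
  lhs
    ∎)
  where
  ι = 1/ (x - 1ℚ)
  κ = 1/ (x - s)
  lhs = (x - (1ℚ + n) * R) * e + a + - ι * (n * a)
  P = a + (x - R - n * R) * e
  Q = ι * (x * x - (R * n + 1ℚ) * x) * e
  polynomial-identity : (x - s) * ι * (((x * x - (R * n + 1ℚ) * x) * κ - R) * e + a) ≡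
                        lhs + ((x - 1ℚ) * ι - 1ℚ) * P + ((x - s) * κ - 1ℚ) * Q
  polynomial-identity = solve 7 (λ x n R e a ι κ →
      (x :- (con 1ℚ :+ n)) :* ι :* (((x :* x :- (R :* n :+ con 1ℚ) :* x) :* κ :- R) :* e :+ a)
    := (x :- (con 1ℚ :+ n) :* R) :* e :+ a :+ (:- ι) :* (n :* a)
       :+ ((x :- con 1ℚ) :* ι :- con 1ℚ) :* (a :+ (x :- R :- n :* R) :* e)
       :+ ((x :- (con 1ℚ :+ n)) :* κ :- con 1ℚ) :* (ι :* (x :* x :- (R :* n :+ con 1ℚ) :* x) :* e))
    refl x n R e a ι κ

module ColumnElimination {n₁ n₂} (r : ℕ) (D₁ : Digraph n₁) (D₂ : Digraph n₂) (regular : OutRegular r D₁)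
  (x : ℚ) {{_ : NonZero (x - 1ℚ)}} {{_ : NonZero (x - ℕtoℚ (suc n₂))}} where

  open Corona D₁ D₂

  ι scale y : ℚ
  ι = 1/ (x - 1ℚ)
  scale = (x - ℕtoℚ (suc n₂)) ÷ (x - 1ℚ)
  y = ((x * x) - (ℕtoℚ (r ℕ.* n₂) + 1ℚ) * x) ÷ (x - ℕtoℚ (suc n₂))

  coefficient : Fin n₁ → Fin (numArcs D₁ ℕ.* n₂) → ℚ
  coefficient v j = - ι * δ v (headOf (proj₁ (remQuot n₂ j)))

  combination : ∀ i v → sum (λ j → coefficient v j * χ x i (n₁ ↑ʳ j)) ≡
                        - ι * sum (λ k → δ v (headOf k) * sum (λ w → χ x i (inCopy k w)))
  combination i v = begin
    sum (λ j → coefficient v j * χ x i (n₁ ↑ʳ j))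
      ≡⟨ sum-combine (numArcs D₁) (λ j → coefficient v j * χ x i (n₁ ↑ʳ j)) ⟩
    sum (λ k → sum (λ w → coefficient v (combine k w) * χ x i (inCopy k w)))
      ≡⟨ sum-cong-≗ (λ k → sum-cong-≗ λ w →
           cong (λ q → - ι * δ v (headOf (proj₁ q)) * χ x i (inCopy k w)) (Finₚ.remQuot-combine k w)) ⟩
    sum (λ k → sum (λ w → - ι * δ v (headOf k) * χ x i (inCopy k w)))
      ≡⟨ sum-cong-≗ (λ k → *-distribˡ-sum (- ι * δ v (headOf k)) (λ w → χ x i (inCopy k w))) ⟨
    sum (λ k → - ι * δ v (headOf k) * sum (λ w → χ x i (inCopy k w)))
      ≡⟨ sum-cong-≗ (λ k → ℚₚ.*-assoc (- ι) (δ v (headOf k)) _) ⟩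
    sum (λ k → - ι * (δ v (headOf k) * sum (λ w → χ x i (inCopy k w))))
      ≡⟨ *-distribˡ-sum (- ι) (λ k → δ v (headOf k) * sum (λ w → χ x i (inCopy k w))) ⟨
    - ι * sum (λ k → δ v (headOf k) * sum (λ w → χ x i (inCopy k w)))
      ∎

  copy-rows-vanish : ∀ k′ w′ v →
    χ x (inCopy k′ w′) (inBase v) + sum (λ j → coefficient v j * χ x (inCopy k′ w′) (n₁ ↑ʳ j)) ≡ 0ℚ
  copy-rows-vanish k′ w′ v = begin
    χ x (inCopy k′ w′) (inBase v) + sum (λ j → coefficient v j * χ x (inCopy k′ w′) (n₁ ↑ʳ j))
      ≡⟨ cong₂ _+_ (χ-inCopy-inBase x k′ w′ v) (combination (inCopy k′ w′) v) ⟩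
    h + - ι * sum (λ k → δ v (headOf k) * sum (λ w → χ x (inCopy k′ w′) (inCopy k w)))
      ≡⟨ cong (λ s → h + - ι * s) copies ⟩
    h + - ι * (h * (x - 1ℚ))
      ≡⟨ solve 3 (λ h ι x → h :+ (:- ι) :* (h :* (x :- con 1ℚ)) := h :* (con 1ℚ :- (x :- con 1ℚ) :* ι)) refl h ι x ⟩
    h * (1ℚ - (x - 1ℚ) * ι)
      ≡⟨ cong (λ c → h * (1ℚ - c)) (ℚₚ.*-inverseʳ (x - 1ℚ)) ⟩
    h * (1ℚ - 1ℚ)
      ≡⟨ ℚₚ.*-zeroʳ h ⟩
    0ℚ
      ∎
    where
    h = δ v (headOf k′)
    copies : sum (λ k → δ v (headOf k) * sum (λ w → χ x (inCopy k′ w′) (inCopy k w))) ≡ h * (x - 1ℚ)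
    copies = trans (sum-cong-≗ λ k → trans (cong (δ v (headOf k) *_) (sum-χ-inCopy x k′ w′ k))
                                           (sym (ℚₚ.*-assoc (δ v (headOf k)) (x - 1ℚ) (δ k′ k))))
                   (sum-δ k′ (λ k → δ v (headOf k) * (x - 1ℚ)))

  lower-left-vanishes : ∀ j v →
    χ x (n₁ ↑ʳ j) (inBase v) + sum (λ j′ → coefficient v j′ * χ x (n₁ ↑ʳ j) (n₁ ↑ʳ j′)) ≡ 0ℚ
  lower-left-vanishes j v =
    subst (λ i → χ x i (inBase v) + sum (λ j′ → coefficient v j′ * χ x i (n₁ ↑ʳ j′)) ≡ 0ℚ)
          (cong (n₁ ↑ʳ_) (Finₚ.combine-remQuot {numArcs D₁} n₂ j))
          (copy-rows-vanish (proj₁ (remQuot {numArcs D₁} n₂ j)) (proj₂ (remQuot {numArcs D₁} n₂ j)) v)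

  base-rows : ∀ u v → χ x (inBase u) (inBase v) + sum (λ j → coefficient v j * χ x (inBase u) (n₁ ↑ʳ j)) ≡
                      scale * charMatrix (laplacian D₁) y u v
  base-rows u v = begin
    χ x (inBase u) (inBase v) + sum (λ j → coefficient v j * χ x (inBase u) (n₁ ↑ʳ j))
      ≡⟨ cong₂ _+_ (χ-inBase x u v) (combination (inBase u) v) ⟩
    (x - (1ℚ + n) * d) * δ u v + a + - ι * sum (λ k → δ v (headOf k) * sum (λ w → χ x (inBase u) (inCopy k w)))
      ≡⟨ cong₂ (λ d s → (x - (1ℚ + n) * d) * δ u v + a + - ι * s) (cong ℕtoℚ (regular u)) arcs-u-v ⟩
    (x - (1ℚ + n) * ℕtoℚ r) * δ u v + a + - ι * (n * a)
      ≡⟨ base-entry-identity x (ℕtoℚ (suc n₂)) n (ℕtoℚ r) (ℕtoℚ (r ℕ.* n₂)) (δ u v) a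
                             (ℕtoℚ-+ 1 n₂) (ℕtoℚ-* r n₂) ⟩
    scale * ((y - ℕtoℚ r) * δ u v + a)
      ≡⟨ cong (λ d → scale * ((y - ℕtoℚ d) * δ u v + a)) (regular u) ⟨
    scale * ((y - d) * δ u v + a)
      ≡⟨ cong (scale *_) (charMatrix-laplacian D₁ y u v) ⟨
    scale * charMatrix (laplacian D₁) y u v
      ∎
    where
    n = ℕtoℚ n₂
    d = ℕtoℚ (outdeg D₁ u)
    a = adjacency D₁ u v
    arcs-u-v : sum (λ k → δ v (headOf k) * sum (λ w → χ x (inBase u) (inCopy k w))) ≡ n * a
    arcs-u-v = begin
      sum (λ k → δ v (headOf k) * sum (λ w → χ x (inBase u) (inCopy k w)))
        ≡⟨ sum-cong-≗ (λ k → cong (δ v (headOf k) *_) (sum-χ-inBase-inCopy x u k)) ⟩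
      sum (λ k → δ v (headOf k) * (n * δ u (tailOf k)))
        ≡⟨ sum-cong-≗ (λ k → solve 3 (λ h n t → h :* (n :* t) := n :* (t :* h)) refl
                                     (δ v (headOf k)) n (δ u (tailOf k))) ⟩
      sum (λ k → n * (δ u (tailOf k) * δ v (headOf k)))
        ≡⟨ *-distribˡ-sum n (λ k → δ u (tailOf k) * δ v (headOf k)) ⟨
      n * sum (λ k → δ u (tailOf k) * δ v (headOf k))
        ≡⟨ cong (n *_) (sum-arcs-between D₁ u v) ⟩
      n * a
        ∎

  upper-left-block : det (λ u v → χ x (inBase u) (inBase v) + sum (λ j → coefficient v j * χ x (inBase u) (n₁ ↑ʳ j))) ≡
                     scale ^ n₁ * charPoly (laplacian D₁) y
  upper-left-block = trans (det-cong base-rows) (det-scale scale (charMatrix (laplacian D₁) y))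

  lower-right-block : det (λ i j → χ x (n₁ ↑ʳ i) (n₁ ↑ʳ j)) ≡ charPoly (laplacian D₂) (x - 1ℚ) ^ (r ℕ.* n₁)
  lower-right-block = trans
    (det-blockDiagonal (numArcs D₁) (λ i j → χ x (n₁ ↑ʳ i) (n₁ ↑ʳ j))
                       (charMatrix (laplacian D₂) (x - 1ℚ)) (χ-inCopy x))
    (cong (charPoly (laplacian D₂) (x - 1ℚ) ^_) (numArcs-outRegular D₁ regular))

corollary4p9 : ∀ {n₁ n₂ : ℕ} (r : ℕ) (D₁ : Digraph n₁) (D₂ : Digraph n₂) →
    OutRegular r D₁ →
    (x : ℚ) → {{_ : NonZero (x - 1ℚ)}} → {{_ : NonZero (x - ℕtoℚ (suc n₂))}} →
    charPoly (laplacian (corona D₁ D₂)) x ≡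
      ((charPoly (laplacian D₂) (x - 1ℚ)) ^ (r Data.Nat.* n₁))
      * (((x - ℕtoℚ (suc n₂)) ÷ (x - 1ℚ)) ^ n₁)
      * charPoly (laplacian D₁)
          (((x * x) - (ℕtoℚ (r Data.Nat.* n₂) + 1ℚ) * x) ÷ (x - ℕtoℚ (suc n₂)))
corollary4p9 {n₁} r D₁ D₂ regular x = begin
  charPoly (laplacian (corona D₁ D₂)) x
    ≡⟨ det-blockElimination n₁ (χ x) coefficient lower-left-vanishes ⟩
  det (λ u v → χ x (inBase u) (inBase v) + sum (λ j → coefficient v j * χ x (inBase u) (n₁ ↑ʳ j)))
    * det (λ i j → χ x (n₁ ↑ʳ i) (n₁ ↑ʳ j))
    ≡⟨ cong₂ _*_ upper-left-block lower-right-block ⟩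
  scale ^ n₁ * f₁ * f₂ ^ (r ℕ.* n₁)
    ≡⟨ solve 3 (λ a b c → a :* b :* c := c :* a :* b) refl (scale ^ n₁) f₁ (f₂ ^ (r ℕ.* n₁)) ⟩
  f₂ ^ (r ℕ.* n₁) * scale ^ n₁ * f₁
    ∎
  where
  open Corona D₁ D₂
  open ColumnElimination r D₁ D₂ regular x
  f₁ = charPoly (laplacian D₁) y
  f₂ = charPoly (laplacian D₂) (x - 1ℚ)
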